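{- There are no non-trivial SCEDFs: if $(G,\cdot)$ is a finite abelian group of order $n$ and $\{A_0,\dots,A_{m-1}\}$ (with $l,m\ge 2$, $c\in\{1,\dots,m-1\}$) is an $(n,m,l;\lambda)$-$c$-SCEDF in $G$, then $m=2c$.
   Context: For subsets $A,B\subseteq G$, $\Delta(A,B)$ is the multiset $\{\{ab^{ -1}: a\in A, b\in B\}\}$. A family $\{A_0,\dots,A_{m-1}\}$ of $m$ pairwise disjoint subsets of $G$ is an $(n,m,l;\lambda)$-$c$-strong circular external difference family (SCEDF) in $G$ if $|A_i|=l$ for all $i$ and, for every $0\le i\le m-1$, $A_{i+c}A_i^{(-1)}=\lambda(G-1_G)$ in the group ring $\mathbb{Z}[G]$, with subscripts modulo $m$; here $\lambda$ is a positive integer. An SCEDF is called trivial if $m=2c$; equivalently, it is obtained by interleaving $c$ pairwise disjoint $(n,2,l;\lambda)$-strong external difference families $\{D^{(i)}_0,D^{(i)}_1\}$ via $A_{i+jc}=D^{(i)}_j$ ($0\le i\le c-1$, $0\le j\le 1$). -}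

module Defs where

open import Level using (Level; 0ℓ)
open import Data.Nat using (ℕ; zero; suc; _+_; _*_; _≤_; NonZero)
open import Data.Nat.DivMod using (_mod_)
open import Data.Fin using (Fin; toℕ)
open import Data.Fin.Subset using (Subset; _∈_; ∣_∣)
open import Data.List using (List; map; allFin)
open import Data.Nat.ListAction using (sum)
open import Data.Empty using (⊥)
open import Data.Product using (_×_; Σ)
open import Relation.Nullary using (¬_; Dec; yes; no)
open import Relation.Binary.PropositionalEquality using (_≡_)
open import Relation.Binary using (Decidable)
open import Algebra.Bundles using (AbelianGroup)
open import Function.Definitions using (Surjective)

countFin : ∀ {n} {P : Fin n → Set} → ((x : Fin n) → Dec (P x)) → ℕ
countFin {n} d = sum (map (λ x → f (d x)) (allFin n))
  where
  f : ∀ {A : Set} → Dec A → ℕ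
  f (yes _) = 1
  f (no _)  = 0

record FiniteAbelianGroup (n : ℕ) : Set₁ where
  field
    G      : AbelianGroup 0ℓ 0ℓ
  open AbelianGroup G public
  field
    enum       : Fin n → Carrier
    enum-inj   : ∀ x y → enum x ≈ enum y → x ≡ y
    enum-surj  : ∀ g → Σ (Fin n) (λ x → enum x ≈ g)
    _≈?_       : Decidable _≈_

module _ {n : ℕ} (𝔾 : FiniteAbelianGroup n) where
  open FiniteAbelianGroup 𝔾

  -- Multiplicity of the element enum x in the multiset
  -- Δ(A,B) = {{ a b⁻¹ : a ∈ A, b ∈ B }}, subsets given as Subset n via enum.
  deltaMult : Subset n → Subset n → Fin n → ℕ
  deltaMult A B x =
    sum (map (λ a → countFin {n}
                      {λ b → (a ∈ A × b ∈ B) × ((enum a - enum b) ≈ enum x)}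
                      (dec a)) (allFin n))
    where
    open import Relation.Nullary.Decidable using (_×-dec_)
    open import Data.Fin.Subset.Properties using (_∈?_)
    dec : ∀ a b → Dec ((a ∈ A × b ∈ B) × ((enum a - enum b) ≈ enum x))
    dec a b = ((a ∈? A) ×-dec (b ∈? B)) ×-dec ((enum a - enum b) ≈? enum x)

  shift : (m : ℕ) .{{_ : NonZero m}} → ℕ → Fin m → Fin m
  shift m c i = (toℕ i + c) mod m

  -- {A_0,…,A_{m-1}} is an (n,m,l;λ)-c-SCEDF in G:
  -- pairwise disjoint, all of size l, λ positive, and for each i,
  -- A_{i+c} A_i^{(-1)} = λ (G − 1_G) in ℤ[G].
  record IsSCEDF (m l c λ' : ℕ) .{{_ : NonZero m}} (A : Fin m → Subset n) : Set where
    field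
      disjoint : ∀ i j → ¬ (i ≡ j) → ∀ x → x ∈ A i → x ∈ A j → ⊥
      size     : ∀ i → ∣ A i ∣ ≡ l
      λ-pos    : 1 ≤ λ'
      diff-id  : ∀ i x → enum x ≈ ε → deltaMult (A (shift m c i)) (A i) x ≡ 0
      diff-nid : ∀ i x → ¬ (enum x ≈ ε) → deltaMult (A (shift m c i)) (A i) x ≡ λ'

{-# OPTIONS --safe #-}

-- In ℤ[G], suppose X Y⁽⁻¹⁾ = λ (G − 1) = Y Z⁽⁻¹⁾ with |X| = |Z|. Since G is abelian,
-- Y⁽⁻¹⁾ Z = (Y Z⁽⁻¹⁾)⁽⁻¹⁾ = λ (G − 1) as well, so X Y⁽⁻¹⁾ Z equals both
-- λ (G − 1) Z = λ (|Z| G − Z) and X λ (G − 1) = λ (|X| G − X); hence X = Z.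
-- For a c-SCEDF take X = A_{2c}, Y = A_c, Z = A_0: the nonempty block A_0 equals A_{2c mod m},
-- so disjointness forces m ∣ 2c, and 0 < 2c < 2m leaves m = 2c.

module Submission where

open import Defs
open import Data.Bool using (if_then_else_)
open import Data.Nat using (ℕ; zero; suc; _+_; _*_; _≤_; _<_; _%_; NonZero; >-nonZero)
open import Data.Nat.Properties
  using (+-*-semiring; +-identityʳ; *-identityˡ; *-identityʳ; *-zeroʳ; *-comm; +-cancelˡ-≡; *-cancelˡ-≡;
         <⇒≤; <⇒≢; <-≤-trans; +-mono-<; +-monoʳ-≤; m≤m+n)
open import Data.Nat.Tactic.RingSolver using (solve-∀)
open import Data.Nat.DivMod using (m<n⇒m%n≡m)
open import Data.Nat.Divisibility using (_∣_; divides; m%n≡0⇒n∣m)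
open import Data.Nat.ListAction using () renaming (sum to sumᴸ)
open import Data.Fin using (Fin; zero; suc; toℕ; _≟_)
open import Data.Fin.Properties using (toℕ-fromℕ<)
open import Data.Fin.Subset using (Subset; inside; outside; _∈_; ∣_∣; Nonempty)
open import Data.Fin.Subset.Properties using (_∈?_; ⊆-antisym; nonempty?; Empty-unique; ∣⊥∣≡0)
open import Data.List using (map; allFin; tabulate)
open import Data.List.Properties using (map-tabulate)
open import Data.Vec using ([]; _∷_)
open import Data.Product using (_×_; _,_; proj₁; proj₂)
open import Function using (_∘_; id)
open import Relation.Nullary using (Dec; yes; no; does; ¬_; contradiction)
open import Relation.Nullary.Decidable using (_×-dec_; decidable-stable)
open import Relation.Binary.PropositionalEquality using (_≡_; refl; sym; trans; cong; cong₂; subst; module ≡-Reasoning)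
open import Algebra.Bundles using (AbelianGroup)
open import Algebra.Properties.Semiring.Sum +-*-semiring
  using (sum-syntax; sum-cong-≗; ∑-distrib-+; ∑-comm; *-distribˡ-sum; sum-replicate-zero)

private
  variable
    A B : Set

𝟙 : Dec A → ℕ
𝟙 a? = if does a? then 1 else 0

𝟙-cong : (A → B) → (B → A) → (a? : Dec A) (b? : Dec B) → 𝟙 a? ≡ 𝟙 b?
𝟙-cong f g (yes a) (yes b) = refl
𝟙-cong f g (yes a) (no ¬b) = contradiction (f a) ¬b
𝟙-cong f g (no ¬a) (yes b) = contradiction (g b) ¬a
𝟙-cong f g (no ¬a) (no ¬b) = refl

𝟙-× : (a? : Dec A) (b? : Dec B) → 𝟙 (a? ×-dec b?) ≡ 𝟙 a? * 𝟙 b?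
𝟙-× (yes _) b? = sym (+-identityʳ (𝟙 b?))
𝟙-× (no _)  b? = refl

𝟙-yes : (a? : Dec A) → A → 𝟙 a? ≡ 1
𝟙-yes (yes _) _ = refl
𝟙-yes (no ¬a) a = contradiction a ¬a

𝟙≡1⇒ : (a? : Dec A) → 𝟙 a? ≡ 1 → A
𝟙≡1⇒ (yes a) _ = a
𝟙≡1⇒ (no _) ()

sum-tabulate : ∀ {k} (f : Fin k → ℕ) → sumᴸ (tabulate f) ≡ ∑[ i < k ] f i
sum-tabulate {zero}  f = refl
sum-tabulate {suc k} f = cong (f zero +_) (sum-tabulate (f ∘ suc))

sum-map-allFin : ∀ {k} (f : Fin k → ℕ) → sumᴸ (map f (allFin k)) ≡ ∑[ i < k ] f i
sum-map-allFin f = trans (cong sumᴸ (map-tabulate id f)) (sum-tabulate f)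

-- The indicator used by countFin is local to Defs; countFin over Fin 1 exposes it.
countFin-1 : (a? : Dec A) → countFin {1} (λ _ → a?) ≡ 𝟙 a?
countFin-1 (yes _) = refl
countFin-1 (no _)  = refl

countFin≡∑𝟙 : ∀ {k} {P : Fin k → Set} (P? : ∀ x → Dec (P x)) →
              countFin P? ≡ ∑[ x < k ] 𝟙 (P? x)
countFin≡∑𝟙 {k} P? = trans (sum-map-allFin {k} _)
  (sum-cong-≗ {k} λ x → trans (sym (+-identityʳ _)) (countFin-1 (P? x)))

∑-δ : ∀ {k} (x : Fin k) (w : Fin k → ℕ) → ∑[ p < k ] (𝟙 (p ≟ x) * w p) ≡ w x
∑-δ {suc k} zero    w = trans (cong (1 * w zero +_) (sum-replicate-zero k))
                              (trans (+-identityʳ _) (*-identityˡ _))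
∑-δ {suc k} (suc x) w = ∑-δ x (w ∘ suc)

∑∑-*-distribˡ : ∀ {k j} c (f : Fin k → Fin j → ℕ) →
                ∑[ a < k ] ∑[ b < j ] (c * f a b) ≡ c * ∑[ a < k ] ∑[ b < j ] f a b
∑∑-*-distribˡ {k} {j} c f = trans (sum-cong-≗ λ a → sym (*-distribˡ-sum c (f a)))
                          (sym (*-distribˡ-sum {k} c (λ a → ∑[ b < j ] f a b)))

∑-weighted-punctured : ∀ {k} λ' (w f : Fin k → ℕ) (x : Fin k) →
                       (∀ p → f p + λ' * 𝟙 (p ≟ x) ≡ λ') →
                       ∑[ p < k ] (w p * f p) + λ' * w x ≡ λ' * ∑[ p < k ] w p
∑-weighted-punctured {k} λ' w f x f+λδ≡λ = begin
    ∑[ p < k ] (w p * f p) + λ' * w x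
  ≡⟨ cong (λ t → ∑[ p < k ] (w p * f p) + λ' * t) (∑-δ x w) ⟨
    ∑[ p < k ] (w p * f p) + λ' * ∑[ p < k ] (𝟙 (p ≟ x) * w p)
  ≡⟨ cong (∑[ p < k ] (w p * f p) +_) (*-distribˡ-sum λ' (λ p → 𝟙 (p ≟ x) * w p)) ⟩
    ∑[ p < k ] (w p * f p) + ∑[ p < k ] (λ' * (𝟙 (p ≟ x) * w p))
  ≡⟨ ∑-distrib-+ (λ p → w p * f p) (λ p → λ' * (𝟙 (p ≟ x) * w p)) ⟨
    ∑[ p < k ] (w p * f p + λ' * (𝟙 (p ≟ x) * w p))
  ≡⟨ sum-cong-≗ (λ p → trans (factor (w p) (f p) (𝟙 (p ≟ x)) λ')
                             (trans (cong (w p *_) (f+λδ≡λ p)) (*-comm (w p) λ'))) ⟩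
    ∑[ p < k ] (λ' * w p)
  ≡⟨ *-distribˡ-sum λ' w ⟨
    λ' * ∑[ p < k ] w p
  ∎
  where
  open ≡-Reasoning
  factor : ∀ w f e λ' → w * f + λ' * (e * w) ≡ w * (f + λ' * e)
  factor = solve-∀

χ : ∀ {k} → Subset k → Fin k → ℕ
χ S x = 𝟙 (x ∈? S)

∣p∣≡∑χ : ∀ {k} (p : Subset k) → ∣ p ∣ ≡ ∑[ x < k ] χ p x
∣p∣≡∑χ []            = refl
∣p∣≡∑χ (inside  ∷ p) = cong suc (∣p∣≡∑χ p)
∣p∣≡∑χ (outside ∷ p) = ∣p∣≡∑χ p

χ-injective : ∀ {k} {S T : Subset k} → (∀ x → χ S x ≡ χ T x) → S ≡ T
χ-injective χS≗χT = ⊆-antisym (∈-transfer χS≗χT) (∈-transfer (sym ∘ χS≗χT))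
  where
  ∈-transfer : ∀ {U V} → (∀ x → χ U x ≡ χ V x) → ∀ {x} → x ∈ U → x ∈ V
  ∈-transfer {U} {V} eq {x} x∈U = 𝟙≡1⇒ (x ∈? V) (trans (sym (eq x)) (𝟙-yes (x ∈? U) x∈U))

1≤∣p∣⇒Nonempty : ∀ {k} {p : Subset k} → 1 ≤ ∣ p ∣ → Nonempty p
1≤∣p∣⇒Nonempty {k} {p} 1≤∣p∣ = decidable-stable (nonempty? p) λ empty →
  <⇒≢ 1≤∣p∣ (sym (trans (cong ∣_∣ (Empty-unique empty)) (∣⊥∣≡0 k)))

module _ {a ℓ} (G : AbelianGroup a ℓ) where
  open AbelianGroup G renaming (sym to ≈-sym; trans to ≈-trans)
  open import Algebra.Properties.AbelianGroup G using (⁻¹-anti-homo‿-; x≈y⇒x∙y⁻¹≈ε; x∙y⁻¹≈ε⇒x≈y)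
  open import Algebra.Properties.CommutativeSemigroup commutativeSemigroup using (interchange)
  open import Relation.Binary.Reasoning.Setoid setoid

  [u-v]-[w-z]≈[u-w]-[v-z] : ∀ u v w z → (u - v) - (w - z) ≈ (u - w) - (v - z)
  [u-v]-[w-z]≈[u-w]-[v-z] u v w z = begin
    (u - v) - (w - z)          ≈⟨ ∙-congˡ (⁻¹-anti-homo‿- w z) ⟩
    (u - v) ∙ (z - w)          ≈⟨ interchange u (v ⁻¹) z (w ⁻¹) ⟩
    (u ∙ z) ∙ (v ⁻¹ ∙ w ⁻¹)    ≈⟨ ∙-congˡ (comm (v ⁻¹) (w ⁻¹)) ⟩
    (u ∙ z) ∙ (w ⁻¹ ∙ v ⁻¹)    ≈⟨ interchange u (w ⁻¹) z (v ⁻¹) ⟨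
    (u - w) ∙ (z - v)          ≈⟨ ∙-congˡ (⁻¹-anti-homo‿- v z) ⟨
    (u - w) - (v - z)          ∎

  u-v≈w-z⇒u-w≈v-z : ∀ {u v w z} → u - v ≈ w - z → u - w ≈ v - z
  u-v≈w-z⇒u-w≈v-z {u} {v} {w} {z} h = x∙y⁻¹≈ε⇒x≈y _ _
    (≈-trans (≈-sym ([u-v]-[w-z]≈[u-w]-[v-z] u v w z)) (x≈y⇒x∙y⁻¹≈ε h))

m∣c+c⇒m≡2c : ∀ {m c} → 1 ≤ c → c < m → m ∣ c + c → m ≡ 2 * c
m∣c+c⇒m≡2c {m} {suc c} _ c<m (divides (suc zero) c+c≡m+0) =
  sym (trans (cong (suc c +_) (+-identityʳ (suc c))) (trans c+c≡m+0 (+-identityʳ m)))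
m∣c+c⇒m≡2c {m} {suc c} _ c<m (divides (suc (suc q)) c+c≡[2+q]m) =
  contradiction c+c≡[2+q]m (<⇒≢ (<-≤-trans (+-mono-< c<m c<m) (+-monoʳ-≤ m (m≤m+n m (q * m)))))

module _ {n : ℕ} (𝔾 : FiniteAbelianGroup n) where
  open FiniteAbelianGroup 𝔾 renaming (refl to ≈-refl; sym to ≈-sym; trans to ≈-trans)
  open import Algebra.Properties.AbelianGroup G using (x≈y⇒x∙y⁻¹≈ε; x∙y⁻¹≈ε⇒x≈y)

  enum-enum≈ε⇒≡ : ∀ {p x} → enum p - enum x ≈ ε → p ≡ x
  enum-enum≈ε⇒≡ {p} {x} h = enum-inj p x (x∙y⁻¹≈ε⇒x≈y _ _ h)

  ≡⇒enum-enum≈ε : ∀ {p x} → p ≡ x → enum p - enum x ≈ ε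
  ≡⇒enum-enum≈ε refl = x≈y⇒x∙y⁻¹≈ε ≈-refl

  Δ : Subset n → Subset n → Carrier → ℕ
  Δ X Y g = ∑[ a < n ] ∑[ b < n ] (χ X a * χ Y b * 𝟙 ((enum a - enum b) ≈? g))

  deltaMult≡Δ : ∀ X Y x → deltaMult 𝔾 X Y x ≡ Δ X Y (enum x)
  deltaMult≡Δ X Y x = trans (sum-map-allFin (λ a → countFin (pair? a)))
    (sum-cong-≗ λ a → trans (countFin≡∑𝟙 (pair? a)) (sum-cong-≗ λ b →
      trans (𝟙-× ((a ∈? X) ×-dec (b ∈? Y)) ((enum a - enum b) ≈? enum x))
            (cong (_* 𝟙 ((enum a - enum b) ≈? enum x)) (𝟙-× (a ∈? X) (b ∈? Y)))))
    where
    pair? : ∀ a b → Dec ((a ∈ X × b ∈ Y) × (enum a - enum b) ≈ enum x)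
    pair? a b = ((a ∈? X) ×-dec (b ∈? Y)) ×-dec ((enum a - enum b) ≈? enum x)

  Δ-cong : ∀ X Y {g h} → g ≈ h → Δ X Y g ≡ Δ X Y h
  Δ-cong X Y g≈h = sum-cong-≗ λ a → sum-cong-≗ λ b → cong (χ X a * χ Y b *_)
    (𝟙-cong (λ e → ≈-trans e g≈h) (λ e → ≈-trans e (≈-sym g≈h))
            ((enum a - enum b) ≈? _) ((enum a - enum b) ≈? _))

  -- X Y⁽⁻¹⁾ = λ' (G − 1_G) in ℤ[G]
  IsDifferencePair : ℕ → Subset n → Subset n → Set
  IsDifferencePair λ' X Y = ∀ g → Δ X Y g + λ' * 𝟙 (g ≈? ε) ≡ λ'

  deltaMult⇒differencePair : ∀ {λ' X Y} →
                   (∀ x → enum x ≈ ε → deltaMult 𝔾 X Y x ≡ 0) →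
                   (∀ x → ¬ enum x ≈ ε → deltaMult 𝔾 X Y x ≡ λ') →
                   IsDifferencePair λ' X Y
  deltaMult⇒differencePair {λ'} {X} {Y} Δ≡0 Δ≡λ g = begin
      Δ X Y g + λ' * 𝟙 (g ≈? ε)
    ≡⟨ cong₂ (λ d e → d + λ' * e) (Δ-cong X Y (≈-sym x≈g))
             (𝟙-cong (≈-trans x≈g) (≈-trans (≈-sym x≈g)) (g ≈? ε) (enum x ≈? ε)) ⟩
      Δ X Y (enum x) + λ' * 𝟙 (enum x ≈? ε)
    ≡⟨ cong (_+ λ' * 𝟙 (enum x ≈? ε)) (deltaMult≡Δ X Y x) ⟨
      deltaMult 𝔾 X Y x + λ' * 𝟙 (enum x ≈? ε)
    ≡⟨ at-x (enum x ≈? ε) ⟩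
      λ'
    ∎
    where
    open ≡-Reasoning
    x : Fin n
    x = proj₁ (enum-surj g)
    x≈g : enum x ≈ g
    x≈g = proj₂ (enum-surj g)
    at-x : (x≈?ε : Dec (enum x ≈ ε)) → deltaMult 𝔾 X Y x + λ' * 𝟙 x≈?ε ≡ λ'
    at-x (yes x≈ε) = trans (cong (_+ λ' * 1) (Δ≡0 x x≈ε)) (*-identityʳ λ')
    at-x (no x≉ε)  = trans (cong (_+ λ' * 0) (Δ≡λ x x≉ε)) (trans (cong (λ' +_) (*-zeroʳ λ')) (+-identityʳ λ'))

  -- the coefficient of enum x in X Y⁽⁻¹⁾ Z ∈ ℤ[G]
  tripleCount : Subset n → Subset n → Subset n → Fin n → ℕ
  tripleCount X Y Z x = ∑[ p < n ] ∑[ b < n ] ∑[ a < n ]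
    (χ X p * χ Y b * χ Z a * 𝟙 ((enum p - enum b) ≈? (enum x - enum a)))

  tripleCount-byFirst : ∀ X Y Z x →
    tripleCount X Y Z x ≡ ∑[ p < n ] (χ X p * Δ Y Z (enum p - enum x))
  tripleCount-byFirst X Y Z x = sum-cong-≗ λ p →
    trans (sum-cong-≗ λ b → sum-cong-≗ λ a → summand p b a) (∑∑-*-distribˡ {n} {n} (χ X p) _)
    where
    reassoc : ∀ u v w e → u * v * w * e ≡ u * (v * w * e)
    reassoc = solve-∀
    summand : ∀ p b a →
      χ X p * χ Y b * χ Z a * 𝟙 ((enum p - enum b) ≈? (enum x - enum a)) ≡
      χ X p * (χ Y b * χ Z a * 𝟙 ((enum b - enum a) ≈? (enum p - enum x)))
    summand p b a = trans
      (cong (χ X p * χ Y b * χ Z a *_)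
            (𝟙-cong (λ h → ≈-sym (u-v≈w-z⇒u-w≈v-z G h)) (λ h → u-v≈w-z⇒u-w≈v-z G (≈-sym h))
                    ((enum p - enum b) ≈? (enum x - enum a)) ((enum b - enum a) ≈? (enum p - enum x))))
      (reassoc (χ X p) (χ Y b) (χ Z a) _)

  tripleCount-byLast : ∀ X Y Z x →
    tripleCount X Y Z x ≡ ∑[ a < n ] (χ Z a * Δ X Y (enum x - enum a))
  tripleCount-byLast X Y Z x = begin
      ∑[ p < n ] ∑[ b < n ] ∑[ a < n ] F p b a
    ≡⟨ sum-cong-≗ (λ p → ∑-comm (F p)) ⟩
      ∑[ p < n ] ∑[ a < n ] ∑[ b < n ] F p b a
    ≡⟨ ∑-comm (λ p a → ∑[ b < n ] F p b a) ⟩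
      ∑[ a < n ] ∑[ p < n ] ∑[ b < n ] F p b a
    ≡⟨ sum-cong-≗ (λ a → trans (sum-cong-≗ λ p → sum-cong-≗ λ b → reorder (χ X p) (χ Y b) (χ Z a) _)
                               (∑∑-*-distribˡ {n} {n} (χ Z a) _)) ⟩
      ∑[ a < n ] (χ Z a * Δ X Y (enum x - enum a))
    ∎
    where
    open ≡-Reasoning
    F : Fin n → Fin n → Fin n → ℕ
    F p b a = χ X p * χ Y b * χ Z a * 𝟙 ((enum p - enum b) ≈? (enum x - enum a))
    reorder : ∀ u v w e → u * v * w * e ≡ w * (u * v * e)
    reorder = solve-∀

  tripleCount-viaYZ : ∀ {λ' X Y Z} → IsDifferencePair λ' Y Z →
                      ∀ x → tripleCount X Y Z x + λ' * χ X x ≡ λ' * ∣ X ∣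
  tripleCount-viaYZ {λ'} {X} {Y} {Z} YZ x = begin
      tripleCount X Y Z x + λ' * χ X x
    ≡⟨ cong (_+ λ' * χ X x) (tripleCount-byFirst X Y Z x) ⟩
      ∑[ p < n ] (χ X p * Δ Y Z (enum p - enum x)) + λ' * χ X x
    ≡⟨ ∑-weighted-punctured λ' (χ X) _ x (λ p →
         trans (cong (λ e → Δ Y Z (enum p - enum x) + λ' * e)
                     (𝟙-cong ≡⇒enum-enum≈ε enum-enum≈ε⇒≡ (p ≟ x) ((enum p - enum x) ≈? ε)))
               (YZ (enum p - enum x))) ⟩
      λ' * ∑[ p < n ] χ X p
    ≡⟨ cong (λ' *_) (∣p∣≡∑χ X) ⟨
      λ' * ∣ X ∣
    ∎
    where open ≡-Reasoning

  tripleCount-viaXY : ∀ {λ' X Y Z} → IsDifferencePair λ' X Y →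
                      ∀ x → tripleCount X Y Z x + λ' * χ Z x ≡ λ' * ∣ Z ∣
  tripleCount-viaXY {λ'} {X} {Y} {Z} XY x = begin
      tripleCount X Y Z x + λ' * χ Z x
    ≡⟨ cong (_+ λ' * χ Z x) (tripleCount-byLast X Y Z x) ⟩
      ∑[ a < n ] (χ Z a * Δ X Y (enum x - enum a)) + λ' * χ Z x
    ≡⟨ ∑-weighted-punctured λ' (χ Z) _ x (λ a →
         trans (cong (λ e → Δ X Y (enum x - enum a) + λ' * e)
                     (𝟙-cong (≡⇒enum-enum≈ε ∘ sym) (sym ∘ enum-enum≈ε⇒≡) (a ≟ x) ((enum x - enum a) ≈? ε)))
               (XY (enum x - enum a))) ⟩
      λ' * ∑[ a < n ] χ Z a
    ≡⟨ cong (λ' *_) (∣p∣≡∑χ Z) ⟨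
      λ' * ∣ Z ∣
    ∎
    where open ≡-Reasoning

  differencePairs⇒≡ : ∀ {λ' X Y Z} → 1 ≤ λ' → ∣ X ∣ ≡ ∣ Z ∣ →
                      IsDifferencePair λ' X Y → IsDifferencePair λ' Y Z → X ≡ Z
  differencePairs⇒≡ {λ'} {X} {Y} {Z} 1≤λ ∣X∣≡∣Z∣ XY YZ = χ-injective λ x →
    *-cancelˡ-≡ (χ X x) (χ Z x) λ' {{>-nonZero 1≤λ}} (+-cancelˡ-≡ (tripleCount X Y Z x) _ _ (begin
      tripleCount X Y Z x + λ' * χ X x  ≡⟨ tripleCount-viaYZ YZ x ⟩
      λ' * ∣ X ∣                         ≡⟨ cong (λ' *_) ∣X∣≡∣Z∣ ⟩
      λ' * ∣ Z ∣                         ≡⟨ tripleCount-viaXY XY x ⟨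
      tripleCount X Y Z x + λ' * χ Z x  ∎))
    where open ≡-Reasoning

  shift²-zero≡zero⇒m≡2c : ∀ {m c} → 1 ≤ c → c < suc m →
                           shift 𝔾 (suc m) c (shift 𝔾 (suc m) c zero) ≡ zero → suc m ≡ 2 * c
  shift²-zero≡zero⇒m≡2c {m} {c} 1≤c c<m shift²-zero≡zero = m∣c+c⇒m≡2c 1≤c c<m
    (m%n≡0⇒n∣m (c + c) (suc m) (begin
      (c + c) % suc m
    ≡⟨ cong (λ t → (t + c) % suc m) (trans (toℕ-fromℕ< _) (m<n⇒m%n≡m c<m)) ⟨
      (toℕ (shift 𝔾 (suc m) c zero) + c) % suc m
    ≡⟨ toℕ-fromℕ< _ ⟨
      toℕ (shift 𝔾 (suc m) c (shift 𝔾 (suc m) c zero))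
    ≡⟨ cong toℕ shift²-zero≡zero ⟩
      0
    ∎))
    where open ≡-Reasoning

corollary2 : (n : ℕ) (𝔾 : FiniteAbelianGroup n)
    (m l c λ' : ℕ) .{{_ : NonZero m}} (A : Fin m → Subset n) →
    2 ≤ l → 2 ≤ m → 1 ≤ c → c < m →
    IsSCEDF 𝔾 m l c λ' A →
    m ≡ 2 * c
corollary2 n 𝔾 (suc m) l c λ' A 2≤l _ 1≤c c<m scedf =
  shift²-zero≡zero⇒m≡2c 𝔾 1≤c c<m i₂≡zero
  where
  open IsSCEDF scedf
  i₁ i₂ : Fin (suc m)
  i₁ = shift 𝔾 (suc m) c zero
  i₂ = shift 𝔾 (suc m) c i₁
  A-pair : ∀ i → IsDifferencePair 𝔾 λ' (A (shift 𝔾 (suc m) c i)) (A i)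
  A-pair i = deltaMult⇒differencePair 𝔾 (diff-id i) (diff-nid i)
  A₂≡A₀ : A i₂ ≡ A zero
  A₂≡A₀ = differencePairs⇒≡ 𝔾 λ-pos (trans (size i₂) (sym (size zero))) (A-pair i₁) (A-pair zero)
  A₀-nonempty : Nonempty (A zero)
  A₀-nonempty = 1≤∣p∣⇒Nonempty (subst (1 ≤_) (sym (size zero)) (<⇒≤ 2≤l))
  i₂≡zero : i₂ ≡ zero
  i₂≡zero = decidable-stable (i₂ ≟ zero) λ i₂≢zero →
    let (a , a∈A₀) = A₀-nonempty in
    disjoint i₂ zero i₂≢zero a (subst (a ∈_) (sym A₂≡A₀) a∈A₀) a∈A₀
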